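{- Let $F$ be a graph of diameter $2$ with $n=|V(F)|$ and minimum degree $t=\delta(F)$, and let $l>n$ be an integer. Let $F_{2l}$ be the graph with vertex set $\{1,2,\dots,2l\}$ whose edges are all pairs $(i,j)$ with $i\ne j$, $i,j\in\{1,\dots,2l-1\}$, $|i-j|\le l-1$, together with the edges $(1,2l),(2,2l),\dots,(t,2l)$. Then $F_{2l}$ has diameter $3$.
   Context: All graphs are finite, simple and undirected. $\delta(F)$ denotes the minimum vertex degree of $F$. -}

module Defs where

open import Data.Nat using (ℕ; zero; suc; _+_; _*_; _∸_; _≤_; _<_; _≤ᵇ_; _≡ᵇ_)
open import Data.Bool using (Bool; true; false; _∧_; _∨_; not)
open import Data.Bool.Properties using (∨-comm)
open import Data.Fin using (Fin; toℕ)
open import Data.List using (List; allFin; map)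
open import Data.Nat.ListAction using (sum)
open import Data.Product using (Σ; ∃; ∃-syntax; _×_; _,_)
open import Relation.Binary.PropositionalEquality using (_≡_; refl; cong₂)
open import Relation.Nullary using (¬_)

record SimpleGraph (n : ℕ) : Set where
  field
    Adj   : Fin n → Fin n → Bool
    sym   : ∀ u v → Adj u v ≡ Adj v u
    loopless : ∀ v → Adj v v ≡ false
open SimpleGraph public

data Walk {n : ℕ} (G : SimpleGraph n) : Fin n → Fin n → ℕ → Set where
  nil  : ∀ {u} → Walk G u u 0
  cons : ∀ {u w v k} → Adj G u w ≡ true → Walk G w v k → Walk G u v (suc k)

DistLe : ∀ {n} → SimpleGraph n → ℕ → Fin n → Fin n → Set
DistLe G k u v = ∃[ j ] (j ≤ k × Walk G u v j)

DistEq : ∀ {n} → SimpleGraph n → ℕ → Fin n → Fin n → Set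
DistEq G d u v = DistLe G d u v × (∀ k → k < d → ¬ DistLe G k u v)

HasDiameter : ∀ {n} → SimpleGraph n → ℕ → Set
HasDiameter {n} G d = (∀ u v → DistLe G d u v) × (∃[ u ] ∃[ v ] DistEq G d u v)

deg : ∀ {n} → SimpleGraph n → Fin n → ℕ
deg {n} G v = sum (map (λ w → if' (Adj G v w)) (allFin n))
  where
  if' : Bool → ℕ
  if' true = 1
  if' false = 0

HasMinDegree : ∀ {n} → SimpleGraph n → ℕ → Set
HasMinDegree {n} G t = (∃[ v ] deg G v ≡ t) × (∀ v → t ≤ deg G v)

-- The graph F_{2l}: vertex i : Fin (2 * l) carries label a = toℕ i + 1 ∈ {1,…,2l}.

coreF : ℕ → ℕ → ℕ → ℕ → Bool
coreF t l a b =
  ((a ≤ᵇ (2 * l ∸ 1)) ∧ (b ≤ᵇ (2 * l ∸ 1)) ∧ ((b ∸ a) ≤ᵇ (l ∸ 1)) ∧ ((a ∸ b) ≤ᵇ (l ∸ 1)))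
  ∨ ((b ≡ᵇ 2 * l) ∧ (a ≤ᵇ t))

adjF : ℕ → ℕ → ℕ → ℕ → Bool
adjF t l a b = not (a ≡ᵇ b) ∧ (coreF t l a b ∨ coreF t l b a)

private
  ≡ᵇ-sym : ∀ a b → (a ≡ᵇ b) ≡ (b ≡ᵇ a)
  ≡ᵇ-sym zero zero = refl
  ≡ᵇ-sym zero (suc b) = refl
  ≡ᵇ-sym (suc a) zero = refl
  ≡ᵇ-sym (suc a) (suc b) = ≡ᵇ-sym a b

  ≡ᵇ-refl : ∀ a → (a ≡ᵇ a) ≡ true
  ≡ᵇ-refl zero = refl
  ≡ᵇ-refl (suc a) = ≡ᵇ-refl a

  adjF-sym : ∀ t l a b → adjF t l a b ≡ adjF t l b a
  adjF-sym t l a b = cong₂ (λ x y → not x ∧ y) (≡ᵇ-sym a b)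
                                (∨-comm (coreF t l a b) (coreF t l b a))

  adjF-irr : ∀ t l a → adjF t l a a ≡ false
  adjF-irr t l a rewrite ≡ᵇ-refl a = refl

F2l : (t l : ℕ) → SimpleGraph (2 * l)
F2l t l = record
  { Adj = λ i j → adjF t l (suc (toℕ i)) (suc (toℕ j))
  ; sym = λ i j → adjF-sym t l (suc (toℕ i)) (suc (toℕ j))
  ; loopless = λ i → adjF-irr t l (suc (toℕ i))
  }

{-# OPTIONS --safe #-}
-- Write l = L + 1. A graph of diameter 2 has no isolated vertex, so 1 ≤ t, and t ≤ n < l.
-- In F_{2l} every vertex 1, …, 2l−1 is equal or adjacent to the middle vertex l, and 2l is
-- adjacent to 1, so all distances are at most 3. The neighbours of 2l are labelled at most
-- t < l, whereas those of 2l−1 are labelled at least l; hence 2l and 2l−1 are at distance 3.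
module Submission where

open import Defs
open import Data.Bool using (Bool; true; false; T; not; _∧_; _∨_)
open import Data.Bool.Properties using (T-∧; T-∨; T-≡)
open import Data.Fin using (Fin; toℕ; fromℕ<) renaming (_≟_ to _≟ᶠ_)
open import Data.Fin.Properties using (toℕ-injective; toℕ<n; toℕ-fromℕ<)
open import Data.List using (List; _∷_; map; allFin; length)
open import Data.List.Properties using (length-tabulate)
open import Data.List.Membership.Propositional using (_∈_)
open import Data.List.Membership.Propositional.Properties using (∈-allFin)
open import Data.List.Relation.Unary.Any using (here; there)
open import Data.Nat
open import Data.Nat.ListAction using (sum)
open import Data.Nat.Properties
open import Data.Product using (∃; _×_; _,_)
open import Data.Product.Function.NonDependent.Propositional using (_×-⇔_)
open import Data.Sum using (_⊎_; inj₁; inj₂)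
open import Data.Sum.Function.Propositional using (_⊎-⇔_)
open import Function.Base using (id)
open import Function.Bundles using (_⇔_; mk⇔; Equivalence)
open import Function.Construct.Composition using (_⇔-∘_)
open import Function.Construct.Symmetry using (⇔-sym)
open import Function.Related.TypeIsomorphisms using (¬-cong-⇔)
open import Relation.Binary.PropositionalEquality as ≡ using (_≡_; _≢_; refl; cong; subst)
open import Relation.Nullary using (¬_; yes; no; contradiction)

open Equivalence using (to; from)

private
  variable
    A : Set
    m a b d : ℕ

sum-map>length⇒ : (f : A → ℕ) (xs : List A) → length xs < sum (map f xs) →
                  ∃ λ x → x ∈ xs × 1 < f x
sum-map>length⇒ f (x ∷ xs) h with 1 <? f x
... | yes 1<fx = x , here refl , 1<fx
... | no 1≮fx with sum-map>length⇒ f xs (+-cancelˡ-< 1 _ _ (<-≤-trans h (+-monoˡ-≤ _ (≮⇒≥ 1≮fx))))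
...   | y , y∈xs , 1<fy = y , there y∈xs , 1<fy

sum-map≡0⇒ : (f : A → ℕ) {x : A} {xs : List A} → x ∈ xs → sum (map f xs) ≡ 0 → f x ≡ 0
sum-map≡0⇒ f (here refl) s≡0 = m+n≡0⇒m≡0 _ s≡0
sum-map≡0⇒ f {xs = y ∷ _} (there x∈xs) s≡0 = sum-map≡0⇒ f x∈xs (m+n≡0⇒n≡0 (f y) s≡0)

module _ {n : ℕ} {G : SimpleGraph n} where

  Adj-sym : ∀ {u v} → Adj G u v ≡ true → Adj G v u ≡ true
  Adj-sym {u} {v} e = ≡.trans (sym G v u) e

  Walk-snoc : ∀ {u v w k} → Walk G u v k → Adj G v w ≡ true → Walk G u w (suc k)
  Walk-snoc nil e = cons e nil
  Walk-snoc (cons e′ p) e = cons e′ (Walk-snoc p e)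

  Walk-++ : ∀ {u v w j k} → Walk G u v j → Walk G v w k → Walk G u w (j + k)
  Walk-++ nil q = q
  Walk-++ (cons e p) q = cons e (Walk-++ p q)

  Walk-reverse : ∀ {u v k} → Walk G u v k → Walk G v u k
  Walk-reverse nil = nil
  Walk-reverse (cons e p) = Walk-snoc (Walk-reverse p) (Adj-sym e)

  Walk-0 : ∀ {u v} → Walk G u v 0 → u ≡ v
  Walk-0 nil = refl

  Walk-1 : ∀ {u v} → Walk G u v 1 → Adj G u v ≡ true
  Walk-1 (cons e nil) = e

  Walk-2 : ∀ {u v} → Walk G u v 2 → ∃ λ w → Adj G u w ≡ true × Adj G w v ≡ true
  Walk-2 (cons e (cons e′ nil)) = _ , e , e′

  Walk⇒neighbour : ∀ {u v k} → Walk G u v k → u ≢ v → ∃ λ w → Adj G u w ≡ true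
  Walk⇒neighbour nil u≢u = contradiction refl u≢u
  Walk⇒neighbour (cons e _) _ = _ , e

  DistLe-refl : ∀ {k u} → DistLe G k u u
  DistLe-refl = 0 , z≤n , nil

  Adj⇒DistLe : ∀ {u v} → Adj G u v ≡ true → DistLe G 1 u v
  Adj⇒DistLe e = 1 , ≤-refl , cons e nil

  DistLe-mono : ∀ {j k u v} → j ≤ k → DistLe G j u v → DistLe G k u v
  DistLe-mono j≤k (i , i≤j , p) = i , ≤-trans i≤j j≤k , p

  DistLe-sym : ∀ {k u v} → DistLe G k u v → DistLe G k v u
  DistLe-sym (i , i≤k , p) = i , i≤k , Walk-reverse p

  DistLe-trans : ∀ {j k u v w} → DistLe G j u v → DistLe G k v w → DistLe G (j + k) u w
  DistLe-trans (i , i≤j , p) (i′ , i′≤k , q) = i + i′ , +-mono-≤ i≤j i′≤k , Walk-++ p q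

  DistEq-intro : ∀ {u v} → DistLe G d u v → (∀ j → j < d → ¬ Walk G u v j) → DistEq G d u v
  DistEq-intro le short = le , λ k k<d (j , j≤k , p) → short j (≤-<-trans j≤k k<d) p

  HasDiameter-suc⇒neighbour : HasDiameter G (suc d) → ∀ v → ∃ λ w → Adj G v w ≡ true
  HasDiameter-suc⇒neighbour (near , a , b , _ , far) v with v ≟ᶠ a
  ... | no v≢a = let (_ , _ , p) = near v a in Walk⇒neighbour p v≢a
  ... | yes refl = let (_ , _ , p) = near v b in Walk⇒neighbour p v≢b
    where
    v≢b : v ≢ b
    v≢b refl = far 0 (s≤s z≤n) DistLe-refl

-- The summands of deg are values of an anonymous 0/1 indicator of Adj G v, which can only be
-- inspected by abstracting over Adj G v w in a hypothesis that mentions them.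
deg≤n : ∀ {n} (G : SimpleGraph n) v → deg G v ≤ n
deg≤n {n} G v with n <? deg G v
... | no n≮deg = ≮⇒≥ n≮deg
... | yes n<deg with sum-map>length⇒ _ (allFin n) (subst (_< deg G v) (≡.sym (length-tabulate id)) n<deg)
...   | w , _ , 1<f with Adj G v w | 1<f
...     | true  | s≤s ()
...     | false | ()

Adj⇒0<deg : ∀ {n} (G : SimpleGraph n) {v w} → Adj G v w ≡ true → 0 < deg G v
Adj⇒0<deg {n} G {v} {w} e with deg G v in deg≡
... | suc _ = s≤s z≤n
... | zero with Adj G v w | e | sum-map≡0⇒ _ (∈-allFin w) deg≡
...   | .true | refl | ()

HasMinDegree⇒≤ : ∀ {n t} {G : SimpleGraph n} → HasMinDegree G t → t ≤ n
HasMinDegree⇒≤ {G = G} ((v , deg≡t) , _) = subst (_≤ _) deg≡t (deg≤n G v)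

HasMinDegree⇒0< : ∀ {n t} {G : SimpleGraph n} → HasDiameter G (suc d) → HasMinDegree G t → 0 < t
HasMinDegree⇒0< {G = G} diam ((v , deg≡t) , _) =
  let (_ , e) = HasDiameter-suc⇒neighbour diam v in subst (0 <_) deg≡t (Adj⇒0<deg G e)

Close : ℕ → ℕ → ℕ → Set
Close l a b = a ≤ 2 * l ∸ 1 × b ≤ 2 * l ∸ 1 × b ∸ a ≤ l ∸ 1 × a ∸ b ≤ l ∸ 1

CoreF : ℕ → ℕ → ℕ → ℕ → Set
CoreF t l a b = Close l a b ⊎ (b ≡ 2 * l × a ≤ t)

AdjF : ℕ → ℕ → ℕ → ℕ → Set
AdjF t l a b = a ≢ b × (CoreF t l a b ⊎ CoreF t l b a)

T-≤ᵇ : T (a ≤ᵇ b) ⇔ a ≤ b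
T-≤ᵇ = mk⇔ (≤ᵇ⇒≤ _ _) ≤⇒≤ᵇ

T-≡ᵇ : T (a ≡ᵇ b) ⇔ a ≡ b
T-≡ᵇ = mk⇔ (≡ᵇ⇒≡ _ _) (≡⇒≡ᵇ _ _)

T-not : ∀ {x} → T (not x) ⇔ (¬ T x)
T-not {false} = mk⇔ (λ _ ()) _
T-not {true}  = mk⇔ (λ ()) (λ ¬tt → ¬tt _)

T-not-cong : ∀ {x} {P : Set} → T x ⇔ P → T (not x) ⇔ (¬ P)
T-not-cong x⇔P = ¬-cong-⇔ x⇔P ⇔-∘ T-not

module _ {x y : Bool} {P Q : Set} where

  T-∧-cong : T x ⇔ P → T y ⇔ Q → T (x ∧ y) ⇔ (P × Q)
  T-∧-cong x⇔P y⇔Q = (x⇔P ×-⇔ y⇔Q) ⇔-∘ T-∧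

  T-∨-cong : T x ⇔ P → T y ⇔ Q → T (x ∨ y) ⇔ (P ⊎ Q)
  T-∨-cong x⇔P y⇔Q = (x⇔P ⊎-⇔ y⇔Q) ⇔-∘ T-∨

T-coreF : ∀ {t l a b} → T (coreF t l a b) ⇔ CoreF t l a b
T-coreF = T-∨-cong (T-∧-cong T-≤ᵇ (T-∧-cong T-≤ᵇ (T-∧-cong T-≤ᵇ T-≤ᵇ)))
                   (T-∧-cong T-≡ᵇ T-≤ᵇ)

adjF⇔AdjF : ∀ {t l a b} → adjF t l a b ≡ true ⇔ AdjF t l a b
adjF⇔AdjF {t} {l} = T-∧-cong (T-not-cong T-≡ᵇ) (T-∨-cong (T-coreF {t} {l}) (T-coreF {t} {l})) ⇔-∘ ⇔-sym T-≡

Close-sym : ∀ {l a b} → Close l a b → Close l b a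
Close-sym (a≤ , b≤ , b∸a≤ , a∸b≤) = b≤ , a≤ , a∸b≤ , b∸a≤

module _ {L : ℕ} where

  2[1+L]∸1≡L+[1+L] : 2 * suc L ∸ 1 ≡ L + suc L
  2[1+L]∸1≡L+[1+L] = cong (λ x → L + suc x) (+-identityʳ L)

  1+L≤2[1+L]∸1 : suc L ≤ 2 * suc L ∸ 1
  1+L≤2[1+L]∸1 = subst (suc L ≤_) (≡.sym 2[1+L]∸1≡L+[1+L]) (m≤n+m (suc L) L)

  Close-middle : 0 < a → a ≤ 2 * suc L ∸ 1 → Close (suc L) a (suc L)
  Close-middle {suc a} _ a≤last =
    a≤last , 1+L≤2[1+L]∸1 , m∸n≤m L a , m≤n+o⇒m∸n≤o (suc a) (suc L) a≤1+L+L
    where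
    a≤1+L+L : suc a ≤ suc L + L
    a≤1+L+L = subst (suc a ≤_) (≡.trans 2[1+L]∸1≡L+[1+L] (+-comm L (suc L))) a≤last

  2[1+L]∸1∸c≤L⇒1+L≤c : ∀ c → 2 * suc L ∸ 1 ∸ c ≤ L → suc L ≤ c
  2[1+L]∸1∸c≤L⇒1+L≤c c h = +-cancelˡ-≤ L (suc L) c (begin
    L + suc L            ≡⟨ 2[1+L]∸1≡L+[1+L] ⟨
    2 * suc L ∸ 1        ≤⟨ m≤n+m∸n _ c ⟩
    c + (2 * suc L ∸ 1 ∸ c) ≤⟨ +-monoʳ-≤ c h ⟩
    c + L                ≡⟨ +-comm c L ⟩
    L + c                ∎)
    where open ≤-Reasoning

  adjF-top⇒≤ : ∀ {t b} → adjF t (suc L) (2 * suc L) b ≡ true → b ≤ t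
  adjF-top⇒≤ {t} adj with to (adjF⇔AdjF {t} {suc L}) adj
  ... | _ , inj₁ (inj₁ (top≤last , _)) = contradiction top≤last (n≮n _)
  ... | top≢b , inj₁ (inj₂ (b≡top , _)) = contradiction (≡.sym b≡top) top≢b
  ... | _ , inj₂ (inj₁ (_ , top≤last , _)) = contradiction top≤last (n≮n _)
  ... | _ , inj₂ (inj₂ (_ , b≤t)) = b≤t

  adjF-last⇒≥ : ∀ {t b} → adjF t (suc L) (2 * suc L ∸ 1) b ≡ true → suc L ≤ b
  adjF-last⇒≥ {t} {b} adj with to (adjF⇔AdjF {t} {suc L}) adj
  ... | _ , inj₁ (inj₁ (_ , _ , _ , last∸b≤L)) = 2[1+L]∸1∸c≤L⇒1+L≤c b last∸b≤L
  ... | _ , inj₁ (inj₂ (b≡top , _)) = subst (suc L ≤_) (≡.sym b≡top) (m≤m+n (suc L) _)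
  ... | _ , inj₂ (inj₁ (_ , _ , last∸b≤L , _)) = 2[1+L]∸1∸c≤L⇒1+L≤c b last∸b≤L
  ... | _ , inj₂ (inj₂ (last≡top , _)) = contradiction (≡.sym last≡top) 1+n≢n

label : Fin m → ℕ
label i = suc (toℕ i)

label-injective : ∀ {i j : Fin m} → label i ≡ label j → i ≡ j
label-injective e = toℕ-injective (suc-injective e)

vertex : ∀ a → 0 < a → a ≤ m → Fin m
vertex (suc a) _ a<m = fromℕ< a<m

label-vertex : ∀ a (0<a : 0 < a) (a≤m : a ≤ m) → label (vertex a 0<a a≤m) ≡ a
label-vertex (suc a) _ a<m = cong suc (toℕ-fromℕ< a<m)

module _ {t L : ℕ} (0<t : 0 < t) (t<1+L : t < suc L) where

  private
    last : ℕ
    last = 2 * suc L ∸ 1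

    G : SimpleGraph (2 * suc L)
    G = F2l t (suc L)

    0<last : 0 < last
    0<last = ≤-trans (s≤s z≤n) 1+L≤2[1+L]∸1

    0<2[1+L] : 0 < 2 * suc L
    0<2[1+L] = s≤s z≤n

    1+L≤2[1+L] : suc L ≤ 2 * suc L
    1+L≤2[1+L] = m≤m+n (suc L) _

    middle one end penultimate : Fin (2 * suc L)
    middle = vertex (suc L) (s≤s z≤n) 1+L≤2[1+L]
    one = vertex 1 (s≤s z≤n) 0<2[1+L]
    end = vertex (2 * suc L) 0<2[1+L] ≤-refl
    penultimate = vertex last 0<last (n≤1+n last)

    label-middle : label middle ≡ suc L
    label-middle = label-vertex (suc L) (s≤s z≤n) 1+L≤2[1+L]

    label-one : label one ≡ 1
    label-one = label-vertex 1 (s≤s z≤n) 0<2[1+L]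

    label-end : label end ≡ 2 * suc L
    label-end = label-vertex (2 * suc L) 0<2[1+L] ≤-refl

    label-penultimate : label penultimate ≡ last
    label-penultimate = label-vertex last 0<last (n≤1+n last)

    Adj-by-labels : ∀ {i j} → label i ≡ a → label j ≡ b → AdjF t (suc L) a b → Adj G i j ≡ true
    Adj-by-labels refl refl = from (adjF⇔AdjF {t} {suc L})

    Adj⇒adjF : ∀ {i j} → label i ≡ a → Adj G i j ≡ true → adjF t (suc L) a (label j) ≡ true
    Adj⇒adjF refl adj = adj

  inner-or-end : ∀ i → label i ≤ last ⊎ i ≡ end
  inner-or-end i with m≤n⇒m<n∨m≡n (toℕ<n i)
  ... | inj₁ i<2l = inj₁ (s≤s⁻¹ i<2l)
  ... | inj₂ i≡2l = inj₂ (label-injective (≡.trans i≡2l (≡.sym label-end)))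

  middle-dist1 : ∀ i → label i ≤ last → DistLe G 1 middle i
  middle-dist1 i i≤last with i ≟ᶠ middle
  ... | yes refl = DistLe-refl
  ... | no i≢middle = Adj⇒DistLe (Adj-by-labels label-middle refl (l≢i , inj₁ (inj₁ close)))
    where
    l≢i : suc L ≢ label i
    l≢i l≡i = i≢middle (label-injective (≡.trans (≡.sym l≡i) (≡.sym label-middle)))
    close : Close (suc L) (suc L) (label i)
    close = Close-sym {suc L} (Close-middle (s≤s z≤n) i≤last)

  inner-dist2 : ∀ i j → label i ≤ last → label j ≤ last → DistLe G 2 i j
  inner-dist2 i j i≤last j≤last = DistLe-trans (DistLe-sym (middle-dist1 i i≤last)) (middle-dist1 j j≤last)

  end~one : Adj G end one ≡ true
  end~one = Adj-by-labels label-end label-one (2l≢1 , inj₂ (inj₂ (refl , 0<t)))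
    where
    2l≢1 : 2 * suc L ≢ 1
    2l≢1 = >⇒≢ (s≤s 0<last)

  one-dist2 : ∀ j → DistLe G 2 one j
  one-dist2 j with inner-or-end j
  ... | inj₁ j≤last = inner-dist2 one j (subst (_≤ last) (≡.sym label-one) 0<last) j≤last
  ... | inj₂ refl = DistLe-mono (n≤1+n 1) (Adj⇒DistLe (Adj-sym {G = G} end~one))

  end-dist3 : ∀ j → DistLe G 3 end j
  end-dist3 j = DistLe-trans (Adj⇒DistLe end~one) (one-dist2 j)

  dist3 : ∀ i j → DistLe G 3 i j
  dist3 i j with inner-or-end i | inner-or-end j
  ... | inj₂ refl   | _           = end-dist3 j
  ... | inj₁ _      | inj₂ refl   = DistLe-sym (end-dist3 i)
  ... | inj₁ i≤last | inj₁ j≤last = DistLe-mono (n≤1+n 2) (inner-dist2 i j i≤last j≤last)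

  end-neighbour≤t : ∀ {w} → Adj G end w ≡ true → label w ≤ t
  end-neighbour≤t adj = adjF-top⇒≤ {L} {t} (Adj⇒adjF label-end adj)

  penultimate-neighbour>t : ∀ {w} → Adj G penultimate w ≡ true → t < label w
  penultimate-neighbour>t adj = <-≤-trans t<1+L (adjF-last⇒≥ {L} {t} (Adj⇒adjF label-penultimate adj))

  no-short-walk : ∀ k → k < 3 → ¬ Walk G end penultimate k
  no-short-walk 0 _ p = 1+n≢n (begin
    suc last          ≡⟨ label-end ⟨
    label end         ≡⟨ cong label (Walk-0 p) ⟩
    label penultimate ≡⟨ label-penultimate ⟩
    last              ∎)
    where open ≡.≡-Reasoning
  no-short-walk 1 _ p = <⇒≱ (<-≤-trans t<1+L 1+L≤2[1+L]∸1)
                             (subst (_≤ t) label-penultimate (end-neighbour≤t (Walk-1 p)))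
  no-short-walk 2 _ p =
    let (_ , e₁ , e₂) = Walk-2 p in <⇒≱ (penultimate-neighbour>t (Adj-sym {G = G} e₂)) (end-neighbour≤t e₁)
  no-short-walk (suc (suc (suc _))) (s≤s (s≤s (s≤s ())))

  F2l-hasDiameter3 : HasDiameter G 3
  F2l-hasDiameter3 = dist3 , end , penultimate , DistEq-intro (dist3 end penultimate) no-short-walk

lemma3 : ∀ (n : ℕ) (F : SimpleGraph n) (t l : ℕ) → HasDiameter F 2 → HasMinDegree F t → n < l
    → HasDiameter (F2l t l) 3
lemma3 n F t zero diam δ ()
lemma3 n F t (suc _) diam δ n<l =
  F2l-hasDiameter3 (HasMinDegree⇒0< {G = F} diam δ) (≤-<-trans (HasMinDegree⇒≤ {G = F} δ) n<l)
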